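{- Let $G$ be a (not necessarily commutative) group and $U'=\{(p,q)\in\mathbb{Z}^2:\gcd(p,q)=1,\ pq\neq 0\}$. The map $\psi$ sending a normalized $G$-valued almost Dedekind symbol $D$ to the function $\psi(D)(p,q)=D(p,q)D(q,-p)^{ -1}$ on $U'$ is a one-to-one correspondence between the set of normalized $G$-valued almost Dedekind symbols and the set of $G$-valued almost reciprocity functions.
   Context: A $G$-valued almost Dedekind symbol is a map $D:U'\to G$ with $D(p,q)=D(p,p+q)$ whenever $p,q,p+q\neq 0$, and $D(p,-q)=D(-p,q)$ whenever $p,q\neq0$ (with $(p,q)$ coprime); it is normalized if $D(1,1)=1$. A $G$-valued almost reciprocity function is a map $F:U'\to G$ with $F(p,q)=F(p,p+q)F(p+q,q)$ whenever $p,q,p+q\neq0$, and $F(p,q)F(-q,p)=1$, $F(p,-q)=F(-p,q)$ whenever $p,q\neq 0$. -}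

module Defs where

open import Level using (Level; _⊔_)
open import Algebra.Bundles using (Group)
open import Data.Integer using (ℤ; _+_; -_; 0ℤ; 1ℤ)
open import Data.Integer.Coprimality using (Coprime)
open import Data.Product using (_×_)
open import Relation.Binary.PropositionalEquality using (_≢_)

InU' : ℤ → ℤ → Set
InU' p q = Coprime p q × p ≢ 0ℤ × q ≢ 0ℤ

-- G-valued maps on U' are represented as total functions ℤ → ℤ → G;
-- only their values on U' matter (all properties / equalities below are
-- restricted to U').
module _ {c ℓ : Level} (G : Group c ℓ) where
  open Group G

  IsAlmostDedekind : (ℤ → ℤ → Carrier) → Set ℓ
  IsAlmostDedekind D =
    (∀ p q → InU' p q → p + q ≢ 0ℤ → D p q ≈ D p (p + q)) ×
    (∀ p q → InU' p q → D p (- q) ≈ D (- p) q)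

  IsNormalizedAlmostDedekind : (ℤ → ℤ → Carrier) → Set ℓ
  IsNormalizedAlmostDedekind D = IsAlmostDedekind D × (D 1ℤ 1ℤ ≈ ε)

  IsAlmostReciprocity : (ℤ → ℤ → Carrier) → Set ℓ
  IsAlmostReciprocity F =
    (∀ p q → InU' p q → p + q ≢ 0ℤ → F p q ≈ F p (p + q) ∙ F (p + q) q) ×
    (∀ p q → InU' p q → F p q ∙ F (- q) p ≈ ε) ×
    (∀ p q → InU' p q → F p (- q) ≈ F (- p) q)

  ψ : (ℤ → ℤ → Carrier) → (ℤ → ℤ → Carrier)
  ψ D p q = D p q ∙ (D q (- p)) ⁻¹

  _≈U'_ : (ℤ → ℤ → Carrier) → (ℤ → ℤ → Carrier) → Set ℓ
  f ≈U' g = ∀ p q → InU' p q → f p q ≈ g p q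

{-# OPTIONS --safe #-}

-- ψ D satisfies the reciprocity laws because, after rewriting with the
-- Dedekind laws, the products of values of ψ D telescope.  For the converse,
-- running Euclid's algorithm backwards shows that a property of points of U'
-- holding at (1, 1) and stable under the rotation (p, q) ↦ (q, -p), under
-- negation and under the shears of positive pairs holds on all of U'.
-- Injectivity: agreement of two symbols with the same ψ propagates along
-- these moves.  Surjectivity: given F, define D (p, q) for p > 0 by the
-- Euclidean recursion D (p, q) = F (p, q mod p) D (q mod p, -p), which is
-- periodic in q by construction, and check D (p, q) = F (p, q) D (q, -p)
-- along the same moves.

module Submission where

open import Defs
open import Level using (Level)
open import Algebra.Bundles using (Group)
open import Data.Integer using (ℤ; +_; +[1+_]; -[1+_]; _+_; -_; _-_; _*_; 0ℤ; 1ℤ; ∣_∣; _%ℕ_; _/ℕ_)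
open import Data.Product using (_×_; Σ; _,_; proj₁; proj₂)
import Data.Integer.Properties as ℤP
import Data.Integer.Coprimality as ℤC
import Data.Integer.Divisibility.Signed as ℤ∣
open import Data.Integer.DivMod using (a≡a%ℕn+[a/ℕn]*n; n%ℕd<d)
open import Data.Integer.Tactic.RingSolver using (solve-∀)
open import Data.Nat as ℕ using (ℕ; zero; suc; s≤s; NonZero)
import Data.Nat.Properties as ℕP
import Data.Nat.Divisibility as ℕ∣
import Data.Nat.Coprimality as ℕC
open import Data.Nat.DivMod using (m<n⇒m%n≡m)
open import Data.Empty using (⊥-elim)
open import Function using (_∘_)
open import Relation.Binary.PropositionalEquality
  using (_≡_; _≢_; refl; sym; trans; cong; subst; module ≡-Reasoning)
open import Relation.Binary.Definitions using (tri<; tri≈; tri>)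

private
  variable
    a b p q r : ℤ

neg-≢0 : p ≢ 0ℤ → - p ≢ 0ℤ
neg-≢0 p≢0 = p≢0 ∘ ℤP.neg-injective

pos-+-≢0 : ∀ m {n} → 0 ℕ.< n → + m + + n ≢ 0ℤ
pos-+-≢0 m {suc n} _ e = ℕP.1+n≢0 (trans (sym (ℕP.+-suc m n)) (ℤP.+-injective e))

[a+b]-a≡b : ∀ a b → (a + b) - a ≡ b
[a+b]-a≡b = solve-∀

b-[a+b]≡-a : ∀ a b → b - (a + b) ≡ - a
b-[a+b]≡-a = solve-∀

coprime-negˡ : ℤC.Coprime p q → ℤC.Coprime (- p) q
coprime-negˡ {p} = subst (λ n → ℕC.Coprime n _) (sym (ℤP.∣-i∣≡∣i∣ p))

coprime-shear : ℤC.Coprime p q → ℤC.Coprime p (p + q)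
coprime-shear {p} {q} c {i} (i∣p , i∣p+q) =
  c (i∣p , ℤ∣.∣⇒∣ᵤ (ℤ∣.∣m+n∣m⇒∣n (ℤ∣.∣ᵤ⇒∣ {+ i} {p + q} i∣p+q) (ℤ∣.∣ᵤ⇒∣ {+ i} {p} i∣p)))

InU'-swap : InU' p q → InU' q p
InU'-swap {p} {q} (c , p≢0 , q≢0) = ℤC.sym {p} {q} c , q≢0 , p≢0

InU'-negˡ : InU' p q → InU' (- p) q
InU'-negˡ {p} {q} (c , p≢0 , q≢0) = coprime-negˡ {p} {q} c , neg-≢0 p≢0 , q≢0

InU'-negʳ : InU' p q → InU' p (- q)
InU'-negʳ = InU'-swap ∘ InU'-negˡ ∘ InU'-swap

InU'-shearʳ : InU' p q → p + q ≢ 0ℤ → InU' p (p + q)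
InU'-shearʳ {p} {q} (c , p≢0 , _) p+q≢0 = coprime-shear {p} {q} c , p≢0 , p+q≢0

InU'-shearˡ : InU' p q → p + q ≢ 0ℤ → InU' (p + q) q
InU'-shearˡ {p} {q} u p+q≢0 = InU'-swap (subst (InU' q) (ℤP.+-comm q p)
  (InU'-shearʳ (InU'-swap u) (p+q≢0 ∘ trans (ℤP.+-comm p q))))

InU'-1-1 : InU' 1ℤ 1ℤ
InU'-1-1 = (λ (i∣1 , _) → ℕ∣.∣1⇒≡1 i∣1) , (λ ()) , (λ ())

∣∧<⇒≡0 : ∀ {d n} → d ℕ∣.∣ n → n ℕ.< d → n ≡ 0
∣∧<⇒≡0 {n = zero}  _   _   = refl
∣∧<⇒≡0 {n = suc n} d∣n n<d = ⊥-elim (ℕP.<⇒≱ n<d (ℕ∣.∣⇒≤ d∣n))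

%ℕ-unique : ∀ q d .{{_ : NonZero d}} r k → r ℕ.< d → q ≡ + r + k * + d → q %ℕ d ≡ r
%ℕ-unique q d r k r<d q≡r+kd = ℤP.+-injective (ℤP.i-j≡0⇒i≡j (+ r′) (+ r) r′-r≡0)
  where
  r′ : ℕ
  r′ = q %ℕ d
  r′-r≡[k-k′]d : + r′ - + r ≡ (k - q /ℕ d) * + d
  r′-r≡[k-k′]d = begin
    + r′ - + r                                 ≡⟨ shift (+ r′) (+ r) (q /ℕ d) k (+ d) ⟩
    (+ r′ + q /ℕ d * + d) - (+ r + k * + d) + (k - q /ℕ d) * + d
      ≡⟨ cong (λ x → x - (+ r + k * + d) + (k - q /ℕ d) * + d)
           (trans (sym (a≡a%ℕn+[a/ℕn]*n q d)) q≡r+kd) ⟩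
    (+ r + k * + d) - (+ r + k * + d) + (k - q /ℕ d) * + d
      ≡⟨ cong (_+ (k - q /ℕ d) * + d) (ℤP.+-inverseʳ (+ r + k * + d)) ⟩
    0ℤ + (k - q /ℕ d) * + d                    ≡⟨ ℤP.+-identityˡ _ ⟩
    (k - q /ℕ d) * + d                         ∎
    where
    open ≡-Reasoning
    shift : ∀ x y k′ k d → x - y ≡ (x + k′ * d) - (y + k * d) + (k - k′) * d
    shift = solve-∀
  ∣r′-r∣<d : ∣ + r′ - + r ∣ ℕ.< d
  ∣r′-r∣<d = ℕP.≤-<-trans
    (subst (ℕ._≤ r′ ℕ.⊔ r) (cong ∣_∣ (sym (ℤP.[+m]-[+n]≡m⊖n r′ r))) (ℤP.∣m⊝n∣≤m⊔n r′ r))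
    (ℕP.⊔-lub (n%ℕd<d q d) r<d)
  r′-r≡0 : + r′ - + r ≡ 0ℤ
  r′-r≡0 = ℤP.∣i∣≡0⇒i≡0 (∣∧<⇒≡0 (ℤ∣.∣⇒∣ᵤ (ℤ∣.divides (k - q /ℕ d) r′-r≡[k-k′]d)) ∣r′-r∣<d)

[d+q]%ℕd≡q%ℕd : ∀ q d .{{_ : NonZero d}} → (+ d + q) %ℕ d ≡ q %ℕ d
[d+q]%ℕd≡q%ℕd q d = %ℕ-unique (+ d + q) d (q %ℕ d) (q /ℕ d + 1ℤ) (n%ℕd<d q d)
  (trans (cong (λ x → + d + x) (a≡a%ℕn+[a/ℕn]*n q d)) (regroup (+ (q %ℕ d)) (q /ℕ d) (+ d)))
  where
  regroup : ∀ r k d → d + (r + k * d) ≡ r + (k + 1ℤ) * d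
  regroup = solve-∀

coprime-unshearʳ : ∀ {m n} → ℕC.Coprime m (m ℕ.+ n) → ℕC.Coprime m n
coprime-unshearʳ c (i∣m , i∣n) = c (i∣m , ℕ∣.∣m∣n⇒∣m+n i∣m i∣n)

coprime-unshearˡ : ∀ {m n} → ℕC.Coprime (m ℕ.+ n) n → ℕC.Coprime m n
coprime-unshearˡ c (i∣m , i∣n) = c (ℕ∣.∣m∣n⇒∣m+n i∣m i∣n , i∣n)

module _ {ℓ : Level} (P : ℕ → ℕ → Set ℓ) (P-1-1 : P 1 1)
  (P-shearʳ : ∀ {m n} → 0 ℕ.< m → 0 ℕ.< n → ℕC.Coprime m n → P m n → P m (m ℕ.+ n))
  (P-shearˡ : ∀ {m n} → 0 ℕ.< m → 0 ℕ.< n → ℕC.Coprime m n → P m n → P (m ℕ.+ n) n)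
  where

  coprime-induction : ∀ {m n} → 0 ℕ.< m → 0 ℕ.< n → ℕC.Coprime m n → P m n
  coprime-induction {m} {n} = bounded (m ℕ.+ n) ℕP.≤-refl
    where
    bounded : ∀ s {m n} → m ℕ.+ n ℕ.≤ s → 0 ℕ.< m → 0 ℕ.< n → ℕC.Coprime m n → P m n
    bounded zero    {suc _} () _ _ _
    bounded (suc s) {m} {n} m+n≤1+s 0<m 0<n c with ℕP.<-cmp m n
    ... | tri≈ _ refl _ = subst (λ x → P x x) (sym (c (ℕ∣.∣-refl , ℕ∣.∣-refl))) P-1-1
    ... | tri< m<n _ _ = subst (P m) m+t≡n
      (P-shearʳ 0<m 0<t c′ (bounded s m+t≤s 0<m 0<t c′))
      where
      t : ℕ
      t = n ℕ.∸ m
      m+t≡n : m ℕ.+ t ≡ n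
      m+t≡n = ℕP.m+[n∸m]≡n (ℕP.<⇒≤ m<n)
      0<t : 0 ℕ.< t
      0<t = ℕP.m<n⇒0<n∸m m<n
      c′ : ℕC.Coprime m t
      c′ = coprime-unshearʳ (subst (ℕC.Coprime m) (sym m+t≡n) c)
      m+t≤s : m ℕ.+ t ℕ.≤ s
      m+t≤s = subst (ℕ._≤ s) (sym m+t≡n) (ℕP.<⇒≤pred (ℕP.<-≤-trans (ℕP.m<n+m n 0<m) m+n≤1+s))
    ... | tri> _ _ n<m = subst (λ x → P x n) t+n≡m
      (P-shearˡ 0<t 0<n c′ (bounded s t+n≤s 0<t 0<n c′))
      where
      t : ℕ
      t = m ℕ.∸ n
      t+n≡m : t ℕ.+ n ≡ m
      t+n≡m = trans (ℕP.+-comm t n) (ℕP.m+[n∸m]≡n (ℕP.<⇒≤ n<m))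
      0<t : 0 ℕ.< t
      0<t = ℕP.m<n⇒0<n∸m n<m
      c′ : ℕC.Coprime t n
      c′ = coprime-unshearˡ (subst (λ x → ℕC.Coprime x n) (sym t+n≡m) c)
      t+n≤s : t ℕ.+ n ℕ.≤ s
      t+n≤s = subst (ℕ._≤ s) (sym t+n≡m) (ℕP.<⇒≤pred (ℕP.<-≤-trans (ℕP.m<m+n m 0<n) m+n≤1+s))

module _ {ℓ : Level} (Q : ℤ → ℤ → Set ℓ) (Q-1-1 : Q 1ℤ 1ℤ)
  (Q-shearʳ : ∀ {m n} → 0 ℕ.< m → 0 ℕ.< n → InU' (+ m) (+ n) →
    Q (+ m) (+ n) → Q (+ m) (+ m + + n))
  (Q-shearˡ : ∀ {m n} → 0 ℕ.< m → 0 ℕ.< n → InU' (+ m) (+ n) →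
    Q (+ m) (+ n) → Q (+ m + + n) (+ n))
  (Q-rotate : ∀ {p q} → InU' p q → Q p q → Q q (- p))
  (Q-negate : ∀ {p q} → InU' p q → Q p q → Q (- p) (- q))
  where

  private
    positive-InU' : ∀ {m n} → 0 ℕ.< m → 0 ℕ.< n → ℕC.Coprime m n → InU' (+ m) (+ n)
    positive-InU' {suc _} {suc _} _ _ c = c , (λ ()) , (λ ())

    positive-quadrant : ∀ {m n} → ℕC.Coprime (suc m) (suc n) → Q +[1+ m ] +[1+ n ]
    positive-quadrant = coprime-induction (λ m n → Q (+ m) (+ n)) Q-1-1
      (λ 0<m 0<n c → Q-shearʳ 0<m 0<n (positive-InU' 0<m 0<n c))
      (λ 0<m 0<n c → Q-shearˡ 0<m 0<n (positive-InU' 0<m 0<n c))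
      (s≤s ℕ.z≤n) (s≤s ℕ.z≤n)

    right-half-plane : ∀ m q → InU' +[1+ m ] q → Q +[1+ m ] q
    right-half-plane m (+ zero)  (_ , _ , q≢0) = ⊥-elim (q≢0 refl)
    right-half-plane m +[1+ n ]  (c , _ , _)   = positive-quadrant c
    right-half-plane m -[1+ n ]  u             = Q-rotate u′ (positive-quadrant (proj₁ u′))
      where
      u′ : InU' +[1+ n ] +[1+ m ]
      u′ = InU'-swap (InU'-negʳ u)

  U'-induction : ∀ p q → InU' p q → Q p q
  U'-induction (+ zero)  q (_ , p≢0 , _) = ⊥-elim (p≢0 refl)
  U'-induction +[1+ m ]  q u = right-half-plane m q u
  U'-induction -[1+ m ]  q u = subst (Q -[1+ m ]) (ℤP.neg-involutive q)
    (Q-negate u′ (right-half-plane m (- q) u′))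
    where
    u′ : InU' +[1+ m ] (- q)
    u′ = InU'-negˡ (InU'-negʳ u)

module _ {c ℓ : Level} (G : Group c ℓ) where
  open Group G renaming (refl to ≈-refl; sym to ≈-sym; trans to ≈-trans; reflexive to ≈-reflexive)
  open import Algebra.Properties.Group G
  open import Relation.Binary.Reasoning.Setoid setoid

  x//y≈z⇒x≈z∙y : ∀ {x y z} → x // y ≈ z → x ≈ z ∙ y
  x//y≈z⇒x≈z∙y {x} {y} x//y≈z = ≈-trans (≈-sym (//-rightDividesˡ y x)) (∙-congʳ x//y≈z)

  x≈z∙y⇒x//y≈z : ∀ {x y z} → x ≈ z ∙ y → x // y ≈ z
  x≈z∙y⇒x//y≈z {x} {y} {z} x≈z∙y = ≈-trans (∙-congʳ x≈z∙y) (//-rightDividesʳ y z)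

  //-telescope : ∀ {x y y′ z} → y ≈ y′ → (x // y) ∙ (y′ // z) ≈ x // z
  //-telescope {x} {y} {y′} {z} y≈y′ = begin
    (x // y) ∙ (y′ // z) ≈⟨ assoc (x // y) y′ (z ⁻¹) ⟨
    ((x // y) ∙ y′) // z ≈⟨ ∙-congʳ (∙-congˡ y≈y′) ⟨
    ((x // y) ∙ y) // z  ≈⟨ ∙-congʳ (//-rightDividesˡ y x) ⟩
    x // z               ∎

  //-cancelˡ : ∀ {x x′ y y′} → x ≈ x′ → x // y ≈ x′ // y′ → y ≈ y′
  //-cancelˡ x≈x′ eq = ⁻¹-injective (∙-cancelˡ _ _ _ (≈-trans (∙-congʳ (≈-sym x≈x′)) eq))

  //-cancelʳ : ∀ {x x′ y y′} → y ≈ y′ → x // y ≈ x′ // y′ → x ≈ x′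
  //-cancelʳ y≈y′ eq = ∙-cancelʳ _ _ _ (≈-trans eq (∙-congˡ (⁻¹-cong (≈-sym y≈y′))))

  x≈y∙z⇒z≈w∙x : ∀ {x y z w} → y ∙ w ≈ ε → x ≈ y ∙ z → z ≈ w ∙ x
  x≈y∙z⇒z≈w∙x {x} {y} {z} {w} y∙w≈ε x≈y∙z = begin
    z               ≈⟨ \\-leftDividesʳ y z ⟨
    y ⁻¹ ∙ (y ∙ z)  ≈⟨ ∙-cong (inverseʳ-unique y w y∙w≈ε) x≈y∙z ⟨
    w ∙ x           ∎

  double-negʳ : ∀ (f : ℤ → ℤ → Carrier) p q → f p q ≈ f p (- (- q))
  double-negʳ f p q = ≈-reflexive (cong (f p) (sym (ℤP.neg-involutive q)))

  module AlmostDedekind {D : ℤ → ℤ → Carrier} (isD : IsAlmostDedekind G D) where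

    shear : InU' p q → p + q ≢ 0ℤ → D p q ≈ D p (p + q)
    shear = proj₁ isD _ _

    flip : InU' p q → D p (- q) ≈ D (- p) q
    flip = proj₂ isD _ _

    negate : InU' p q → D p q ≈ D (- p) (- q)
    negate {p} {q} u = ≈-trans (double-negʳ D p q) (flip (InU'-negʳ u))

    shear-≡ : InU' p q → p + q ≡ r → r ≢ 0ℤ → D p q ≈ D p r
    shear-≡ {p} u refl r≢0 = shear u r≢0

    D[a+b,-a]≈D[a+b,b] : InU' a b → a + b ≢ 0ℤ → D (a + b) (- a) ≈ D (a + b) b
    D[a+b,-a]≈D[a+b,b] {a} {b} u a+b≢0 = shear-≡
      (InU'-negʳ (InU'-swap (InU'-shearʳ u a+b≢0))) ([a+b]-a≡b a b) (proj₂ (proj₂ u))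

    D[b,-[a+b]]≈D[b,-a] : InU' a b → a + b ≢ 0ℤ → D b (- (a + b)) ≈ D b (- a)
    D[b,-[a+b]]≈D[b,-a] {a} {b} u a+b≢0 = shear-≡
      (InU'-negʳ (InU'-swap (InU'-shearˡ u a+b≢0))) (b-[a+b]≡-a a b) (neg-≢0 (proj₁ (proj₂ u)))

  ψ-isAlmostReciprocity : ∀ {D} → IsAlmostDedekind G D → IsAlmostReciprocity G (ψ G D)
  ψ-isAlmostReciprocity {D} isD = ψ-cocycle , ψ-inverse , ψ-flip
    where
    open AlmostDedekind isD

    ψ-cocycle : ∀ p q → InU' p q → p + q ≢ 0ℤ → ψ G D p q ≈ ψ G D p (p + q) ∙ ψ G D (p + q) q
    ψ-cocycle p q u p+q≢0 = begin
      D p q // D q (- p)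
        ≈⟨ //-cong₂ (shear u p+q≢0) (≈-sym (D[b,-[a+b]]≈D[b,-a] u p+q≢0)) ⟩
      D p (p + q) // D q (- (p + q))
        ≈⟨ //-telescope (D[a+b,-a]≈D[a+b,b] u p+q≢0) ⟨
      ψ G D p (p + q) ∙ ψ G D (p + q) q  ∎

    ψ-inverse : ∀ p q → InU' p q → ψ G D p q ∙ ψ G D (- q) p ≈ ε
    ψ-inverse p q u = begin
      ψ G D p q ∙ ψ G D (- q) p  ≈⟨ //-telescope (flip (InU'-swap u)) ⟩
      D p q // D p (- (- q))     ≈⟨ x≈y⇒x∙y⁻¹≈ε (double-negʳ D p q) ⟩
      ε                          ∎

    ψ-flip : ∀ p q → InU' p q → ψ G D p (- q) ≈ ψ G D (- p) q
    ψ-flip p q u = //-cong₂ (flip u) (≈-trans (≈-sym (negate (InU'-swap u))) (double-negʳ D q p))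

  ψ-injective : ∀ {D D′} → IsAlmostDedekind G D → IsAlmostDedekind G D′ →
    D 1ℤ 1ℤ ≈ D′ 1ℤ 1ℤ → _≈U'_ G (ψ G D) (ψ G D′) → _≈U'_ G D D′
  ψ-injective {D} {D′} isD isD′ D≈D′-at-1-1 ψD≈ψD′ =
    U'-induction Agree D≈D′-at-1-1 agree-shearʳ agree-shearˡ agree-rotate agree-negate
    where
    module D = AlmostDedekind isD
    module D′ = AlmostDedekind isD′

    Agree : ℤ → ℤ → Set ℓ
    Agree p q = D p q ≈ D′ p q

    agree-rotate : InU' p q → Agree p q → Agree q (- p)
    agree-rotate u e = //-cancelˡ e (ψD≈ψD′ _ _ u)

    agree-unrotate : InU' p q → Agree q (- p) → Agree p q
    agree-unrotate u e = //-cancelʳ e (ψD≈ψD′ _ _ u)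

    agree-negate : InU' p q → Agree p q → Agree (- p) (- q)
    agree-negate u e = ≈-trans (≈-sym (D.negate u)) (≈-trans e (D′.negate u))

    agree-shearʳ : ∀ {m n} → 0 ℕ.< m → 0 ℕ.< n → InU' (+ m) (+ n) →
      Agree (+ m) (+ n) → Agree (+ m) (+ m + + n)
    agree-shearʳ {m} _ 0<n u e =
      ≈-trans (≈-sym (D.shear u (pos-+-≢0 m 0<n))) (≈-trans e (D′.shear u (pos-+-≢0 m 0<n)))

    agree-shearˡ : ∀ {m n} → 0 ℕ.< m → 0 ℕ.< n → InU' (+ m) (+ n) →
      Agree (+ m) (+ n) → Agree (+ m + + n) (+ n)
    agree-shearˡ {m} {n} _ 0<n u e = agree-unrotate (InU'-shearˡ u m+n≢0)
      (≈-trans (D.D[b,-[a+b]]≈D[b,-a] u m+n≢0)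
        (≈-trans (agree-rotate u e) (≈-sym (D′.D[b,-[a+b]]≈D[b,-a] u m+n≢0))))
      where
      m+n≢0 : + m + + n ≢ 0ℤ
      m+n≢0 = pos-+-≢0 m 0<n

  module AlmostReciprocity {F : ℤ → ℤ → Carrier} (isF : IsAlmostReciprocity G F) where

    cocycle : InU' p q → p + q ≢ 0ℤ → F p q ≈ F p (p + q) ∙ F (p + q) q
    cocycle = proj₁ isF _ _

    rotate-inverse : InU' p q → F p q ∙ F (- q) p ≈ ε
    rotate-inverse = proj₁ (proj₂ isF) _ _

    flip : InU' p q → F p (- q) ≈ F (- p) q
    flip = proj₂ (proj₂ isF) _ _

    negate : InU' p q → F p q ≈ F (- p) (- q)
    negate {p} {q} u = ≈-trans (double-negʳ F p q) (flip (InU'-negʳ u))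

  -- ψ D p q ≈ F p q with the inverse cleared.
  Reciprocity : (D F : ℤ → ℤ → Carrier) → ℤ → ℤ → Set ℓ
  Reciprocity D F p q = D p q ≈ F p q ∙ D q (- p)

  module _ {D F : ℤ → ℤ → Carrier}
    (isD : IsAlmostDedekind G D) (isF : IsAlmostReciprocity G F) where
    private
      module D = AlmostDedekind isD
      module F = AlmostReciprocity isF

    reciprocity-rotate : InU' p q → Reciprocity D F p q → Reciprocity D F q (- p)
    reciprocity-rotate u rec = ≈-trans (x≈y∙z⇒z≈w∙x (F.rotate-inverse u) rec)
      (∙-cong (≈-sym (F.flip (InU'-swap u))) (D.negate u))

    reciprocity-negate : InU' p q → Reciprocity D F p q → Reciprocity D F (- p) (- q)
    reciprocity-negate u rec = ≈-trans (≈-sym (D.negate u))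
      (≈-trans rec (∙-cong (F.negate u) (D.negate (InU'-negʳ (InU'-swap u)))))

    reciprocity-shearʳ : InU' a b → a + b ≢ 0ℤ → Reciprocity D F (a + b) b →
      Reciprocity D F a b → Reciprocity D F a (a + b)
    reciprocity-shearʳ {a} {b} u a+b≢0 rec[a+b,b] rec[a,b] = begin
      D a (a + b)                                    ≈⟨ D.shear u a+b≢0 ⟨
      D a b                                          ≈⟨ rec[a,b] ⟩
      F a b ∙ D b (- a)                              ≈⟨ ∙-congʳ (F.cocycle u a+b≢0) ⟩
      (F a (a + b) ∙ F (a + b) b) ∙ D b (- a)        ≈⟨ assoc _ _ _ ⟩
      F a (a + b) ∙ (F (a + b) b ∙ D b (- a))
        ≈⟨ ∙-congˡ (∙-congˡ (D.D[b,-[a+b]]≈D[b,-a] u a+b≢0)) ⟨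
      F a (a + b) ∙ (F (a + b) b ∙ D b (- (a + b)))  ≈⟨ ∙-congˡ rec[a+b,b] ⟨
      F a (a + b) ∙ D (a + b) b
        ≈⟨ ∙-congˡ (D.D[a+b,-a]≈D[a+b,b] u a+b≢0) ⟨
      F a (a + b) ∙ D (a + b) (- a)                  ∎

  module Preimage {F : ℤ → ℤ → Carrier} (isF : IsAlmostReciprocity G F) where

    -- D (1, q) is forced: ε for q > 0 by normalization, and F (1, -1) for
    -- q < 0 since ψ D (1, 1) = F (1, 1).  The value at q = 0 is junk.
    atOne : ℤ → Carrier
    atOne +[1+ _ ] = ε
    atOne _        = F 1ℤ -[1+ 0 ]

    -- euclid n p q is D (p, q) for 0 < p ≤ n; the first argument is fuel.
    euclid : ℕ → ℕ → ℤ → Carrier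
    euclid _       zero               _ = ε
    euclid zero    (suc _)            _ = ε
    euclid (suc _) (suc zero)         q = atOne q
    euclid (suc n) p@(suc (suc _))    q = F (+ p) (+ (q %ℕ p)) ∙ euclid n (q %ℕ p) (- (+ p))

    dedekind : ℤ → ℤ → Carrier
    dedekind (+ p)    q = euclid p p q
    dedekind -[1+ m ] q = euclid (suc m) (suc m) (- q)

    euclid-fuel : ∀ {m n} k q → k ℕ.≤ m → k ℕ.≤ n → euclid m k q ≡ euclid n k q
    euclid-fuel zero               q _ _ = refl
    euclid-fuel (suc zero)         q (s≤s _) (s≤s _) = refl
    euclid-fuel k@(suc (suc _))    q (s≤s k≤1+m) (s≤s k≤1+n) = cong (F (+ k) (+ (q %ℕ k)) ∙_)
      (euclid-fuel (q %ℕ k) (- (+ k)) (ℕP.≤-trans q%k≤k-1 k≤1+m) (ℕP.≤-trans q%k≤k-1 k≤1+n))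
      where
      q%k≤k-1 : q %ℕ k ℕ.≤ ℕ.pred k
      q%k≤k-1 = ℕP.<⇒≤pred (n%ℕd<d q k)

    atOne-periodic : ∀ q → q ≢ 0ℤ → 1ℤ + q ≢ 0ℤ → atOne q ≡ atOne (1ℤ + q)
    atOne-periodic (+ zero)       q≢0 _ = ⊥-elim (q≢0 refl)
    atOne-periodic +[1+ _ ]       _   _ = refl
    atOne-periodic -[1+ zero ]    _   1+q≢0 = ⊥-elim (1+q≢0 refl)
    atOne-periodic -[1+ suc _ ]   _   _ = refl

    euclid-periodic : ∀ m q → q ≢ 0ℤ → +[1+ m ] + q ≢ 0ℤ →
      euclid (suc m) (suc m) q ≡ euclid (suc m) (suc m) (+[1+ m ] + q)
    euclid-periodic zero    q = atOne-periodic q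
    euclid-periodic (suc m) q _ _ =
      cong (λ r → F (+ suc (suc m)) (+ r) ∙ euclid (suc m) r (- (+ suc (suc m))))
        (sym ([d+q]%ℕd≡q%ℕd q (suc (suc m))))

    dedekind-shear : ∀ p q → InU' p q → p + q ≢ 0ℤ → dedekind p q ≈ dedekind p (p + q)
    dedekind-shear (+ zero) _ (_ , p≢0 , _) _ = ⊥-elim (p≢0 refl)
    dedekind-shear +[1+ m ] q (_ , _ , q≢0) p+q≢0 = ≈-reflexive (euclid-periodic m q q≢0 p+q≢0)
    dedekind-shear -[1+ m ] q (_ , _ , q≢0) p+q≢0 = ≈-reflexive
      (trans (euclid-periodic m (- q) (neg-≢0 q≢0) (p+q≢0 ∘ ℤP.neg-injective ∘ trans -[p+q]≡))
             (cong (euclid (suc m) (suc m)) (sym -[p+q]≡)))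
      where
      -[p+q]≡ : - (-[1+ m ] + q) ≡ +[1+ m ] + - q
      -[p+q]≡ = ℤP.neg-distrib-+ -[1+ m ] q

    dedekind-flip : ∀ p q → InU' p q → dedekind p (- q) ≈ dedekind (- p) q
    dedekind-flip (+ zero) _ (_ , p≢0 , _) = ⊥-elim (p≢0 refl)
    dedekind-flip +[1+ m ] q _ = ≈-refl
    dedekind-flip -[1+ m ] q _ = ≈-reflexive (cong (euclid (suc m) (suc m)) (ℤP.neg-involutive q))

    dedekind-isAlmostDedekind : IsAlmostDedekind G dedekind
    dedekind-isAlmostDedekind = dedekind-shear , dedekind-flip

    reciprocity-below-diagonal : ∀ {m n} → 0 ℕ.< n → n ℕ.< m →
      Reciprocity dedekind F (+ m) (+ n)
    reciprocity-below-diagonal {m@(suc (suc k))} {n} _ n<m@(s≤s n≤1+k) = ≈-reflexive (trans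
      (cong (λ r → F (+ m) (+ r) ∙ euclid (suc k) r (- (+ m))) (m<n⇒m%n≡m n<m))
      (cong (F (+ m) (+ n) ∙_) (euclid-fuel n (- (+ m)) n≤1+k ℕP.≤-refl)))
    reciprocity-below-diagonal {suc zero} {suc _} _ (s≤s ())

    dedekind-reciprocity : ∀ p q → InU' p q → Reciprocity dedekind F p q
    dedekind-reciprocity = U'-induction (Reciprocity dedekind F) base shearʳ shearˡ
      (reciprocity-rotate dedekind-isAlmostDedekind isF)
      (reciprocity-negate dedekind-isAlmostDedekind isF)
      where
      module F = AlmostReciprocity isF

      base : Reciprocity dedekind F 1ℤ 1ℤ
      base = ≈-sym (≈-trans (∙-congˡ (F.flip InU'-1-1)) (F.rotate-inverse InU'-1-1))

      shearˡ : ∀ {m n} → 0 ℕ.< m → 0 ℕ.< n → InU' (+ m) (+ n) →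
        Reciprocity dedekind F (+ m) (+ n) → Reciprocity dedekind F (+ m + + n) (+ n)
      shearˡ 0<m 0<n _ _ = reciprocity-below-diagonal 0<n (ℕP.m<n+m _ 0<m)

      shearʳ : ∀ {m n} → 0 ℕ.< m → 0 ℕ.< n → InU' (+ m) (+ n) →
        Reciprocity dedekind F (+ m) (+ n) → Reciprocity dedekind F (+ m) (+ m + + n)
      shearʳ {m} 0<m 0<n u = reciprocity-shearʳ dedekind-isAlmostDedekind isF u (pos-+-≢0 m 0<n)
        (reciprocity-below-diagonal 0<n (ℕP.m<n+m _ 0<m))

  ψ-surjective : ∀ {F} → IsAlmostReciprocity G F →
    Σ (ℤ → ℤ → Carrier) (λ D → IsNormalizedAlmostDedekind G D × _≈U'_ G (ψ G D) F)
  ψ-surjective isF = dedekind , (dedekind-isAlmostDedekind , ≈-refl) ,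
    λ p q u → x≈z∙y⇒x//y≈z (dedekind-reciprocity p q u)
    where open Preimage isF

theorem3p10 : {c ℓ : Level} (G : Group c ℓ) →
    -- ψ maps normalized almost Dedekind symbols to almost reciprocity functions
    ((D : ℤ → ℤ → Group.Carrier G) → IsNormalizedAlmostDedekind G D →
      IsAlmostReciprocity G (ψ G D)) ×
    -- ψ is injective (as a map of functions on U')
    ((D D′ : ℤ → ℤ → Group.Carrier G) → IsNormalizedAlmostDedekind G D →
      IsNormalizedAlmostDedekind G D′ → _≈U'_ G (ψ G D) (ψ G D′) → _≈U'_ G D D′) ×
    -- ψ is surjective onto almost reciprocity functions
    ((F : ℤ → ℤ → Group.Carrier G) → IsAlmostReciprocity G F →
      Σ (ℤ → ℤ → Group.Carrier G) (λ D →
        IsNormalizedAlmostDedekind G D × _≈U'_ G (ψ G D) F))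
theorem3p10 G =
  (λ D (isD , _) → ψ-isAlmostReciprocity G isD) ,
  (λ D D′ (isD , D-normalized) (isD′ , D′-normalized) →
    ψ-injective G isD isD′ (Group.trans G D-normalized (Group.sym G D′-normalized))) ,
  (λ F → ψ-surjective G)
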